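{- There is no $*$-term $P$ such that $\mathrm{fe}(P) = X[\Box\mapsto Y]$ for some $X \in \mathcal{T}_{\Box}$ and $Y \in \mathcal{T}$ where $X \neq \Box$, $X$ contains $\Box$, and $X$ contains neither $\mathsf{T}$ nor $\mathsf{F}$.
   Context: Let $A$ be a countable set of atoms. FEL-terms: $P ::= a \ (a\in A) \mid \mathsf{T} \mid \mathsf{F} \mid \neg P \mid (P \wedge^{\bullet} P) \mid (P \vee^{\bullet} P)$ (full left-sequential connectives). Subgrammars ($a\in A$): $\mathsf{T}$-terms $P^{\mathsf{T}} ::= \mathsf{T} \mid a \vee^{\bullet} P^{\mathsf{T}}$; $\ell$-terms $P^{\ell} ::= a \wedge^{\bullet} P^{\mathsf{T}} \mid \neg a \wedge^{\bullet} P^{\mathsf{T}}$; $*$-terms $P^* ::= P^c \mid P^d$, $P^c ::= P^{\ell} \mid P^* \wedge^{\bullet} P^d$, $P^d ::= P^{\ell} \mid P^* \vee^{\bullet} P^c$. $\mathcal{T}$ is the set of finite binary trees with leaves in $\{\mathsf{T},\mathsf{F}\}$: $\mathsf{T},\mathsf{F}\in\mathcal{T}$, $(X \trianglelefteq a \trianglerighteq Y)\in\mathcal{T}$ for $X,Y\in\mathcal{T}$, $a\in A$; $\mathcal{T}_{\Box}$ is the analogous set with leaves in $\{\mathsf{T},\mathsf{F},\Box\}$. Leaf replacement $X[\ell_1\mapsto Y_1,\ell_2\mapsto Y_2]$ replaces every leaf $\ell_i$ by $Y_i$, other leaves unchanged. $\mathrm{fe}$: $\mathrm{fe}(\mathsf{T})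 = \mathsf{T}$, $\mathrm{fe}(\mathsf{F}) = \mathsf{F}$, $\mathrm{fe}(a) = \mathsf{T} \trianglelefteq a \trianglerighteq \mathsf{F}$, $\mathrm{fe}(\neg P) = \mathrm{fe}(P)[\mathsf{T}\mapsto\mathsf{F}, \mathsf{F}\mapsto\mathsf{T}]$, $\mathrm{fe}(P \wedge^{\bullet} Q) = \mathrm{fe}(P)[\mathsf{T}\mapsto \mathrm{fe}(Q), \mathsf{F}\mapsto \mathrm{fe}(Q)[\mathsf{T}\mapsto\mathsf{F}]]$, $\mathrm{fe}(P \vee^{\bullet} Q) = \mathrm{fe}(P)[\mathsf{T}\mapsto \mathrm{fe}(Q)[\mathsf{F}\mapsto\mathsf{T}], \mathsf{F}\mapsto \mathrm{fe}(Q)]$. -}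

module Defs where

open import Data.Nat using (ℕ)

-- Atoms: the countable set A is taken to be ℕ.
Atom : Set
Atom = ℕ

data FEL : Set where
  atom : Atom → FEL
  `T `F : FEL
  ¬●_ : FEL → FEL
  _∧●_ _∨●_ : FEL → FEL → FEL

data TTerm : FEL → Set where
  tT  : TTerm `T
  tOr : ∀ a {P} → TTerm P → TTerm (atom a ∨● P)

data LTerm : FEL → Set where
  lPos : ∀ a {P} → TTerm P → LTerm (atom a ∧● P)
  lNeg : ∀ a {P} → TTerm P → LTerm ((¬● atom a) ∧● P)

data StarTerm : FEL → Set
data CTerm : FEL → Set
data DTerm : FEL → Set

data StarTerm where
  sC : ∀ {P} → CTerm P → StarTerm P
  sD : ∀ {P} → DTerm P → StarTerm P

data CTerm where
  cL   : ∀ {P} → LTerm P → CTerm P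
  cAnd : ∀ {P Q} → StarTerm P → DTerm Q → CTerm (P ∧● Q)

data DTerm where
  dL  : ∀ {P} → LTerm P → DTerm P
  dOr : ∀ {P Q} → StarTerm P → CTerm Q → DTerm (P ∨● Q)

data Leaf : Set where
  lT lF : Leaf

data LeafB : Set where
  bT bF □ : LeafB

-- Finite binary trees with leaves in L and inner nodes labelled by atoms:
-- Tree Leaf is 𝒯, Tree LeafB is 𝒯_□.
data Tree (L : Set) : Set where
  leaf : L → Tree L
  node : Tree L → Atom → Tree L → Tree L   -- node X a Y  =  X ⊴ a ⊵ Y

replace : ∀ {L M : Set} → Tree L → (L → Tree M) → Tree M
replace (leaf l) f = f l
replace (node X a Y) f = node (replace X f) a (replace Y f)

_[T↦_,F↦_] : Tree Leaf → Tree Leaf → Tree Leaf → Tree Leaf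
X [T↦ Y₁ ,F↦ Y₂ ] = replace X λ { lT → Y₁ ; lF → Y₂ }

_[T↦_] : Tree Leaf → Tree Leaf → Tree Leaf
X [T↦ Y ] = X [T↦ Y ,F↦ leaf lF ]

_[F↦_] : Tree Leaf → Tree Leaf → Tree Leaf
X [F↦ Y ] = X [T↦ leaf lT ,F↦ Y ]

_[□↦_] : Tree LeafB → Tree Leaf → Tree Leaf
X [□↦ Y ] = replace X λ { bT → leaf lT ; bF → leaf lF ; □ → Y }

fe : FEL → Tree Leaf
fe (atom a) = node (leaf lT) a (leaf lF)
fe `T = leaf lT
fe `F = leaf lF
fe (¬● P) = fe P [T↦ leaf lF ,F↦ leaf lT ]
fe (P ∧● Q) = fe P [T↦ fe Q ,F↦ fe Q [T↦ leaf lF ] ]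
fe (P ∨● Q) = fe P [T↦ fe Q [F↦ leaf lT ] ,F↦ fe Q ]

data Contains {L : Set} (ℓ : L) : Tree L → Set where
  here  : Contains ℓ (leaf ℓ)
  left  : ∀ {X a Y} → Contains ℓ X → Contains ℓ (node X a Y)
  right : ∀ {X a Y} → Contains ℓ Y → Contains ℓ (node X a Y)

module Submission where

-- Call two trees *similar* (≈) when they have the same skeleton
-- and the same leaves, ignoring the atoms at inner nodes.  We show that the
-- full evaluation of every *-term has the shape  L ⊴ a ⊵ R  where L and R are
-- perfect trees of the same depth that are NOT similar, and that it contains
-- both leaves T and F (`StarShape`).  This holds for ℓ-terms directly, and it
-- survives the two ways *-terms are built, because fe (P ∧● Q) and fe (P ∨● Q)
-- replace the leaves of fe P by two perfect, dissimilar trees of equal depth.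
--
-- On the other side, if X ≠ □ has only □-leaves, then X = X₁ ⊴ b ⊵ X₂ and,
-- when X[□ ↦ Y] has perfect subtrees of equal depth, X₁ and X₂ are perfect of
-- equal depth as well; two such □-only trees are similar, hence so are
-- X₁[□ ↦ Y] and X₂[□ ↦ Y], contradicting the shape of fe P.

open import Defs
open import Data.Nat using (ℕ; suc; _+_)
open import Data.Nat.Properties using (+-identityʳ; +-cancelʳ-≡)
open import Data.Product using (Σ; _×_; _,_)
open import Data.Empty using (⊥-elim)
open import Relation.Binary.PropositionalEquality
  using (_≡_; _≢_; refl; sym; trans; cong; subst)
open import Relation.Nullary using (¬_)

infix 4 _≈_
data _≈_ {L : Set} : Tree L → Tree L → Set where
  lf : ∀ l → leaf l ≈ leaf l
  nd : ∀ {A A′ B B′ a b} → A ≈ A′ → B ≈ B′ → node A a B ≈ node A′ b B′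

≈-refl : ∀ {L} (A : Tree L) → A ≈ A
≈-refl (leaf l)     = lf l
≈-refl (node A _ B) = nd (≈-refl A) (≈-refl B)

≈-sym : ∀ {L} {A B : Tree L} → A ≈ B → B ≈ A
≈-sym (lf l)   = lf l
≈-sym (nd p q) = nd (≈-sym p) (≈-sym q)

data Perfect {L : Set} : ℕ → Tree L → Set where
  pleaf : ∀ {l} → Perfect 0 (leaf l)
  pnode : ∀ {n A a B} → Perfect n A → Perfect n B → Perfect (suc n) (node A a B)

perfect-depth-unique : ∀ {L a b} {Z : Tree L} → Perfect a Z → Perfect b Z → a ≡ b
perfect-depth-unique pleaf       pleaf       = refl
perfect-depth-unique (pnode p _) (pnode q _) = cong suc (perfect-depth-unique p q)

perfect-replace : ∀ {L M n m} {Z : Tree L} (f : L → Tree M) →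
                  (∀ l → Perfect m (f l)) → Perfect n Z → Perfect (n + m) (replace Z f)
perfect-replace f hf pleaf       = hf _
perfect-replace f hf (pnode p q) = pnode (perfect-replace f hf p) (perfect-replace f hf q)

perfect-relabel : ∀ {L M n} {Z : Tree L} (f : L → Tree M) →
                  (∀ l → Perfect 0 (f l)) → Perfect n Z → Perfect n (replace Z f)
perfect-relabel {n = n} f hf p = subst (λ k → Perfect k _) (+-identityʳ n) (perfect-replace f hf p)

contains-replace : ∀ {L M} {x : L} {y : M} {Z : Tree L} (f : L → Tree M) →
                   Contains x Z → Contains y (f x) → Contains y (replace Z f)
contains-replace f here      c = c
contains-replace f (left p)  c = left (contains-replace f p c)
contains-replace f (right p) c = right (contains-replace f p c)

replace-moves : ∀ {L} {x : L} {Z : Tree L} (f : L → Tree L) →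
                Contains x Z → ¬ (leaf x ≈ f x) → ¬ (Z ≈ replace Z f)
replace-moves f here      moved e        = moved e
replace-moves f (left c)  moved (nd e _) = replace-moves f c moved e
replace-moves f (right c) moved (nd _ e) = replace-moves f c moved e

replace-reflects-≈ : ∀ {L M n} {A B : Tree L} (f : L → Tree M) →
                     (∀ {l l′} → f l ≈ f l′ → l ≡ l′) →
                     Perfect n A → Perfect n B → replace A f ≈ replace B f → A ≈ B
replace-reflects-≈ f faithful (pleaf {l}) pleaf e with faithful e
... | refl = lf l
replace-reflects-≈ f faithful (pnode p q) (pnode p′ q′) (nd e e′) =
  nd (replace-reflects-≈ f faithful p p′ e) (replace-reflects-≈ f faithful q q′ e′)

≈-replace : ∀ {L M} {A B : Tree L} (f : L → Tree M) → A ≈ B → replace A f ≈ replace B f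
≈-replace f (lf l)   = ≈-refl (f l)
≈-replace f (nd p q) = nd (≈-replace f p) (≈-replace f q)

data StarShape : Tree Leaf → Set where
  starShape : ∀ {n L a R} → Perfect n L → Perfect n R → ¬ (L ≈ R) →
              Contains lT (node L a R) → Contains lF (node L a R) →
              StarShape (node L a R)

starShape-perfect : ∀ {Z} → StarShape Z → Σ ℕ λ n → Perfect n Z
starShape-perfect (starShape pL pR _ _ _) = _ , pnode pL pR

-- Conditions on the trees Y₁, Y₂ substituted for T and F under which
-- Z[T ↦ Y₁, F ↦ Y₂] keeps the StarShape of Z.
record Admissible (Y₁ Y₂ : Tree Leaf) : Set where
  field
    depth    : ℕ
    perfect₁ : Perfect depth Y₁
    perfect₂ : Perfect depth Y₂
    hasT     : Contains lT Y₁
    hasF     : Contains lF Y₂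
    distinct : ¬ (Y₁ ≈ Y₂)

starShape-replace : ∀ {Z Y₁ Y₂} → StarShape Z → Admissible Y₁ Y₂ →
                    StarShape (Z [T↦ Y₁ ,F↦ Y₂ ])
starShape-replace {Y₁ = Y₁} {Y₂} (starShape pL pR L≉R cT cF) adm =
  starShape (perfect-replace f perfect pL) (perfect-replace f perfect pR)
            (λ e → L≉R (replace-reflects-≈ f faithful pL pR e))
            (contains-replace f cT hasT) (contains-replace f cF hasF)
  where
    open Admissible adm
    f : Leaf → Tree Leaf
    f l = leaf l [T↦ Y₁ ,F↦ Y₂ ]
    perfect : ∀ l → Perfect depth (f l)
    perfect lT = perfect₁
    perfect lF = perfect₂
    faithful : ∀ {l l′} → f l ≈ f l′ → l ≡ l′
    faithful {lT} {lT} _ = refl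
    faithful {lT} {lF} e = ⊥-elim (distinct e)
    faithful {lF} {lT} e = ⊥-elim (distinct (≈-sym e))
    faithful {lF} {lF} _ = refl

-- The continuations used by ∧●: Z on T and Z[T ↦ F] on F.
∧-admissible : ∀ {Z} → StarShape Z → Admissible Z (Z [T↦ leaf lF ])
∧-admissible s@(starShape _ _ _ cT cF) with starShape-perfect s
... | n , pZ = record
  { depth = n ; perfect₁ = pZ ; perfect₂ = perfect-relabel _ (λ { lT → pleaf ; lF → pleaf }) pZ
  ; hasT = cT ; hasF = contains-replace _ cF here
  ; distinct = replace-moves _ cT (λ ()) }

-- The continuations used by ∨●: Z[F ↦ T] on T and Z on F.
∨-admissible : ∀ {Z} → StarShape Z → Admissible (Z [F↦ leaf lT ]) Z
∨-admissible s@(starShape _ _ _ cT cF) with starShape-perfect s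
... | n , pZ = record
  { depth = n ; perfect₁ = perfect-relabel _ (λ { lT → pleaf ; lF → pleaf }) pZ ; perfect₂ = pZ
  ; hasT = contains-replace _ cT here ; hasF = cF
  ; distinct = λ e → replace-moves _ cF (λ ()) (≈-sym e) }

fe-TTerm : ∀ {P} → TTerm P → Σ ℕ λ m → Perfect m (fe P) × Contains lT (fe P)
fe-TTerm tT = 0 , pleaf , here
fe-TTerm (tOr a t) with fe-TTerm t
... | m , p , c = suc m , pnode (perfect-relabel _ (λ { lT → pleaf ; lF → pleaf }) p) p , right c

-- ℓ-terms have StarShape: their two subtrees are fe P and fe P[T ↦ F].
fe-LTerm : ∀ {P} → LTerm P → StarShape (fe P)
fe-LTerm (lPos a t) with fe-TTerm t
... | _ , p , c = starShape p (perfect-relabel _ (λ { lT → pleaf ; lF → pleaf }) p)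
                            (replace-moves _ c (λ ()))
                            (left c) (right (contains-replace _ c here))
fe-LTerm (lNeg a t) with fe-TTerm t
... | _ , p , c = starShape (perfect-relabel _ (λ { lT → pleaf ; lF → pleaf }) p) p
                            (λ e → replace-moves _ c (λ ()) (≈-sym e))
                            (right c) (left (contains-replace _ c here))

fe-StarTerm : ∀ {P} → StarTerm P → StarShape (fe P)
fe-CTerm    : ∀ {P} → CTerm P → StarShape (fe P)
fe-DTerm    : ∀ {P} → DTerm P → StarShape (fe P)
fe-StarTerm (sC c)     = fe-CTerm c
fe-StarTerm (sD d)     = fe-DTerm d
fe-CTerm (cL l)        = fe-LTerm l
fe-CTerm (cAnd s d)    = starShape-replace (fe-StarTerm s) (∧-admissible (fe-DTerm d))
fe-DTerm (dL l)        = fe-LTerm l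
fe-DTerm (dOr s c)     = starShape-replace (fe-StarTerm s) (∨-admissible (fe-CTerm c))

data Uniform {L : Set} (x : L) : Tree L → Set where
  uleaf : Uniform x (leaf x)
  unode : ∀ {A a B} → Uniform x A → Uniform x B → Uniform x (node A a B)

only-□ : (X : Tree LeafB) → ¬ Contains bT X → ¬ Contains bF X → Uniform □ X
only-□ (leaf bT)     noT _   = ⊥-elim (noT here)
only-□ (leaf bF)     _   noF = ⊥-elim (noF here)
only-□ (leaf □)      _   _   = uleaf
only-□ (node A _ B) noT noF =
  unode (only-□ A (λ c → noT (left c)) (λ c → noF (left c)))
        (only-□ B (λ c → noT (right c)) (λ c → noF (right c)))

uniform-filling-perfect : ∀ {L M k} {x : L} {X : Tree L} (f : L → Tree M) →
                          Uniform x X → Perfect k (replace X f) → Σ ℕ λ m → Perfect m (f x)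
uniform-filling-perfect f uleaf       p           = _ , p
uniform-filling-perfect f (unode u _) (pnode p _) = uniform-filling-perfect f u p

uniform-depth : ∀ {L M k m} {x : L} {X : Tree L} (f : L → Tree M) →
                Uniform x X → Perfect k (replace X f) → Perfect m (f x) →
                Σ ℕ λ d → Perfect d X × d + m ≡ k
uniform-depth f uleaf p q = 0 , pleaf , perfect-depth-unique q p
uniform-depth {m = m} f (unode uA uB) (pnode pA pB) q
  with uniform-depth f uA pA q | uniform-depth f uB pB q
... | dA , qA , eA | dB , qB , eB =
  suc dA , pnode qA (subst (λ d → Perfect d _) (sym dA≡dB) qB) , cong suc eA
  where
    dA≡dB : dA ≡ dB
    dA≡dB = +-cancelʳ-≡ m dA dB (trans eA (sym eB))

uniform-similar : ∀ {L d} {x : L} {A B : Tree L} →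
                  Uniform x A → Uniform x B → Perfect d A → Perfect d B → A ≈ B
uniform-similar {x = x} uleaf uleaf _ _ = lf x
uniform-similar uleaf (unode _ _) pleaf ()
uniform-similar (unode _ _) uleaf () pleaf
uniform-similar (unode uA uB) (unode uA′ uB′) (pnode pA pB) (pnode pA′ pB′) =
  nd (uniform-similar uA uA′ pA pA′) (uniform-similar uB uB′ pB pB′)

uniform-context-not-starShape : ∀ {X Y} → Uniform □ X → X ≢ leaf □ → ¬ StarShape (X [□↦ Y ])
uniform-context-not-starShape uleaf X≢□ _ = X≢□ refl
uniform-context-not-starShape (unode u₁ u₂) _ (starShape p₁ p₂ dissimilar _ _)
  with uniform-filling-perfect _ u₁ p₁
... | _ , pY with uniform-depth _ u₁ p₁ pY | uniform-depth _ u₂ p₂ pY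
... | d₁ , q₁ , e₁ | d₂ , q₂ , e₂ with +-cancelʳ-≡ _ d₁ d₂ (trans e₁ (sym e₂))
... | refl = dissimilar (≈-replace _ (uniform-similar u₁ u₂ q₁ q₂))

-- Theorem: no *-term evaluates to X[□ ↦ Y] for a context X ≠ □ whose only
-- leaves are □.
mainTheorem15 : ¬ (Σ FEL λ P → StarTerm P × (Σ (Tree LeafB) λ X → Σ (Tree Leaf) λ Y →
                    fe P ≡ X [□↦ Y ] × X ≢ leaf □ × Contains □ X
                    × ¬ Contains bT X × ¬ Contains bF X))
mainTheorem15 (P , star , X , Y , feP≡X[Y] , X≢□ , _ , noT , noF) =
  uniform-context-not-starShape (only-□ X noT noF) X≢□
    (subst StarShape feP≡X[Y] (fe-StarTerm star))
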